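{- Let $r\ge1$ and $n$ be integers with $2r+5\le n\le 3r+1$, and write $n=2r+1+q$ (so $4\le q\le r$). Let $C_n$ be the cycle with vertices $x_1,\dots,x_n$ labeled consecutively (indices taken modulo $n$), and let $D\subseteq V(C_n)$. Then $D$ is an $r$-identifying code of $C_n$ if and only if (1) for every $i\in\{1,\dots,n\}$, $x_i\in D$ or $x_{i+q}\in D$; and (2) there is at most one set of the form $\{x_{i+1},x_{i+2},\dots,x_{i+q}\}$ ($i\in\{1,\dots,n\}$) none of whose elements is in $D$.
   Context: For a graph $G=(V,E)$ and integer $r\ge1$, $d(x,y)$ is the number of edges in a shortest path between $x$ and $y$, $N_r[x]=\{y\in V: d(x,y)\le r\}$, and for $D\subseteq V$, $D_r(x)=N_r[x]\cap D$. A set $D\subseteq V$ is an $r$-identifying code of $G$ if $D_r(x)\neq\emptyset$ for every $x\in V$ and $D_r(x)\neq D_r(y)$ for all distinct $x,y\in V$. -}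

module Defs where

open import Data.Nat using (ℕ; zero; suc; _+_; _≤_; NonZero)
open import Data.Nat.DivMod using (_%_)
open import Data.Fin using (Fin; toℕ)
open import Data.Fin.Subset using (Subset; _∈_; _∉_)
open import Data.Product using (Σ; _×_; ∃-syntax)
open import Data.Sum using (_⊎_)
open import Relation.Binary.PropositionalEquality using (_≡_)
open import Relation.Nullary using (¬_)
open import Function.Bundles using (_⇔_)

Graph : ℕ → Set₁
Graph n = Fin n → Fin n → Set

data Walk {n : ℕ} (G : Graph n) : ℕ → Fin n → Fin n → Set where
  here : ∀ {x} → Walk G zero x x
  step : ∀ {k x y z} → G x y → Walk G k y z → Walk G (suc k) x z

DistLE : ∀ {n} → Graph n → ℕ → Fin n → Fin n → Set
DistLE G r x y = ∃[ k ] (k ≤ r × Walk G k x y)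

InDr : ∀ {n} → Graph n → ℕ → Subset n → Fin n → Fin n → Set
InDr G r D x z = DistLE G r x z × z ∈ D

IsIdentifyingCode : ∀ {n} → Graph n → ℕ → Subset n → Set
IsIdentifyingCode {n} G r D =
  (∀ (x : Fin n) → ∃[ z ] InDr G r D x z)
  × (∀ (x y : Fin n) → ¬ (x ≡ y) → ¬ (∀ (z : Fin n) → InDr G r D x z ⇔ InDr G r D y z))

-- x_{i+k}: vertex index shifted by k modulo n (vertices x_0,…,x_{n-1} ≅ Fin n)
shift : ∀ {n} .{{_ : NonZero n}} → Fin n → ℕ → Fin n
shift {n} i k = Data.Fin.fromℕ< (Data.Nat.DivMod.m%n<n (toℕ i + k) n)

Cycle : (n : ℕ) .{{_ : NonZero n}} → Graph n
Cycle n x y = (y ≡ shift x 1) ⊎ (x ≡ shift y 1)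

InWindow : ∀ {n} .{{_ : NonZero n}} → ℕ → Fin n → Fin n → Set
InWindow q i z = ∃[ j ] ((1 ≤ j × j ≤ q) × z ≡ shift i j)

module Submission where

-- Write n = 2r+1+q and W(i) = {x_{i+1},…,x_{i+q}} for the "window" of q
-- vertices following x_i.  On C_n the closed r-ball around x misses exactly the
-- q vertices diametrically opposite to x, namely W(x+r); hence
-- D_r(x) = D ∖ W(x+r).  As x ↦ x+r is a rotation, D is an r-identifying code
-- iff the sets D ∖ W(i) are non-empty and pairwise distinct ("separating").  Windows at rotation distance d with d ≤ q or n−d ≤ q
-- are told apart by condition (1) applied to x_{i+1}; windows farther apart are
-- disjoint, so if they are not told apart both are free, contradicting (2).

open import Data.Empty using (⊥; ⊥-elim)
open import Data.Fin using (Fin; toℕ)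
open import Data.Fin.Properties using (toℕ-injective; toℕ-fromℕ<; toℕ<n) renaming (_≟_ to _≟ᶠ_)
open import Data.Fin.Subset using (Subset; _∈_; _∉_)
open import Data.Fin.Subset.Properties using (_∈?_)
open import Data.Nat
open import Data.Nat.DivMod using (_%_; m%n<n; m%n%n≡m%n; %-distribˡ-+; [m+n]%n≡m%n; m<n⇒m%n≡m)
open import Data.Nat.Properties
open import Data.Nat.Tactic.RingSolver using (solve-∀)
open import Data.Product using (_×_; _,_; proj₂; ∃₂; ∃-syntax)
open import Data.Sum using (_⊎_; inj₁; inj₂)
open import Function.Bundles using (_⇔_; mk⇔; Equivalence)
import Function.Properties.Equivalence as ⇔
open import Relation.Binary.PropositionalEquality
open import Relation.Nullary using (¬_; yes; no)

open import Defs

module Rotation (m : ℕ) where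

  N : ℕ
  N = suc m

  toℕ-shift : (x : Fin N) (k : ℕ) → toℕ (shift x k) ≡ (toℕ x + k) % N
  toℕ-shift x k = toℕ-fromℕ< _

  %-absorbˡ : ∀ a k → (a % N + k) % N ≡ (a + k) % N
  %-absorbˡ a k = begin
    (a % N + k) % N          ≡⟨ %-distribˡ-+ (a % N) k N ⟩
    (a % N % N + k % N) % N  ≡⟨ cong (λ t → (t + k % N) % N) (m%n%n≡m%n a N) ⟩
    (a % N + k % N) % N      ≡⟨ %-distribˡ-+ a k N ⟨
    (a + k) % N              ∎
    where open ≡-Reasoning

  %-absorbʳ : ∀ a k → (a + k % N) % N ≡ (a + k) % N
  %-absorbʳ a k = begin
    (a + k % N) % N  ≡⟨ cong (_% N) (+-comm a (k % N)) ⟩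
    (k % N + a) % N  ≡⟨ %-absorbˡ k a ⟩
    (k + a) % N      ≡⟨ cong (_% N) (+-comm k a) ⟩
    (a + k) % N      ∎
    where open ≡-Reasoning

  shift-+ : (x : Fin N) (a b : ℕ) → shift (shift x a) b ≡ shift x (a + b)
  shift-+ x a b = toℕ-injective (begin
    toℕ (shift (shift x a) b)  ≡⟨ toℕ-shift (shift x a) b ⟩
    (toℕ (shift x a) + b) % N  ≡⟨ cong (λ t → (t + b) % N) (toℕ-shift x a) ⟩
    ((toℕ x + a) % N + b) % N  ≡⟨ %-absorbˡ (toℕ x + a) b ⟩
    (toℕ x + a + b) % N        ≡⟨ cong (_% N) (+-assoc (toℕ x) a b) ⟩
    (toℕ x + (a + b)) % N      ≡⟨ toℕ-shift x (a + b) ⟨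
    toℕ (shift x (a + b))      ∎)
    where open ≡-Reasoning

  shift-0 : (x : Fin N) → shift x 0 ≡ x
  shift-0 x = toℕ-injective (begin
    toℕ (shift x 0)  ≡⟨ toℕ-shift x 0 ⟩
    (toℕ x + 0) % N  ≡⟨ cong (_% N) (+-identityʳ (toℕ x)) ⟩
    toℕ x % N        ≡⟨ m<n⇒m%n≡m (toℕ<n x) ⟩
    toℕ x            ∎)
    where open ≡-Reasoning

  shift-N : (x : Fin N) → shift x N ≡ x
  shift-N x = toℕ-injective (begin
    toℕ (shift x N)  ≡⟨ toℕ-shift x N ⟩
    (toℕ x + N) % N  ≡⟨ [m+n]%n≡m%n (toℕ x) N ⟩
    toℕ x % N        ≡⟨ m<n⇒m%n≡m (toℕ<n x) ⟩
    toℕ x            ∎)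
    where open ≡-Reasoning

  shift-turn : (x : Fin N) {a b : ℕ} → a + b ≡ N → shift (shift x a) b ≡ x
  shift-turn x {a} {b} a+b≡N = trans (shift-+ x a b) (trans (cong (shift x) a+b≡N) (shift-N x))

  -- The position of z as seen from x: the unique o < N with z = x + o.
  offset : Fin N → Fin N → ℕ
  offset x z = (toℕ z + (N ∸ toℕ x)) % N

  offset<N : (x z : Fin N) → offset x z < N
  offset<N x z = m%n<n (toℕ z + (N ∸ toℕ x)) N

  private
    x+[N∸x]≡N : (x : Fin N) → toℕ x + (N ∸ toℕ x) ≡ N
    x+[N∸x]≡N x = m+[n∸m]≡n (<⇒≤ (toℕ<n x))

  shift-offset : (x z : Fin N) → shift x (offset x z) ≡ z
  shift-offset x z = toℕ-injective (begin
    toℕ (shift x (offset x z))                    ≡⟨ toℕ-shift x (offset x z) ⟩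
    (toℕ x + (toℕ z + (N ∸ toℕ x)) % N) % N       ≡⟨ %-absorbʳ (toℕ x) (toℕ z + (N ∸ toℕ x)) ⟩
    (toℕ x + (toℕ z + (N ∸ toℕ x))) % N           ≡⟨ cong (_% N) (x+[z+y]≡z+[x+y] (toℕ x) (toℕ z) _) ⟩
    (toℕ z + (toℕ x + (N ∸ toℕ x))) % N           ≡⟨ cong (λ t → (toℕ z + t) % N) (x+[N∸x]≡N x) ⟩
    (toℕ z + N) % N                               ≡⟨ [m+n]%n≡m%n (toℕ z) N ⟩
    toℕ z % N                                     ≡⟨ m<n⇒m%n≡m (toℕ<n z) ⟩
    toℕ z                                         ∎)
    where
    open ≡-Reasoning
    x+[z+y]≡z+[x+y] : ∀ a b c → a + (b + c) ≡ b + (a + c)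
    x+[z+y]≡z+[x+y] = solve-∀

  offset-shift : (x : Fin N) {a : ℕ} → a < N → offset x (shift x a) ≡ a
  offset-shift x {a} a<N = begin
    (toℕ (shift x a) + (N ∸ toℕ x)) % N     ≡⟨ cong (λ t → (t + (N ∸ toℕ x)) % N) (toℕ-shift x a) ⟩
    ((toℕ x + a) % N + (N ∸ toℕ x)) % N     ≡⟨ %-absorbˡ (toℕ x + a) (N ∸ toℕ x) ⟩
    (toℕ x + a + (N ∸ toℕ x)) % N           ≡⟨ cong (_% N) (x+a+y≡a+[x+y] (toℕ x) a _) ⟩
    (a + (toℕ x + (N ∸ toℕ x))) % N         ≡⟨ cong (λ t → (a + t) % N) (x+[N∸x]≡N x) ⟩
    (a + N) % N                             ≡⟨ [m+n]%n≡m%n a N ⟩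
    a % N                                   ≡⟨ m<n⇒m%n≡m a<N ⟩
    a                                       ∎
    where
    open ≡-Reasoning
    x+a+y≡a+[x+y] : ∀ b c d → b + c + d ≡ c + (b + d)
    x+a+y≡a+[x+y] = solve-∀

  shift-injective : (x : Fin N) {a b : ℕ} → a < N → b < N → shift x a ≡ shift x b → a ≡ b
  shift-injective x {a} {b} a<N b<N e =
    trans (sym (offset-shift x a<N)) (trans (cong (offset x) e) (offset-shift x b<N))

  walk-forward : ∀ k (x : Fin N) → Walk (Cycle N) k x (shift x k)
  walk-forward zero x = subst (Walk (Cycle N) 0 x) (sym (shift-0 x)) here
  walk-forward (suc k) x =
    step (inj₁ refl) (subst (Walk (Cycle N) k (shift x 1)) (shift-+ x 1 k) (walk-forward k (shift x 1)))

  walk-backward : ∀ k (x : Fin N) → Walk (Cycle N) k (shift x k) x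
  walk-backward zero x = subst (λ w → Walk (Cycle N) 0 w x) (sym (shift-0 x)) here
  walk-backward (suc k) x =
    step (inj₂ (trans (cong (shift x) (+-comm 1 k)) (sym (shift-+ x k 1)))) (walk-backward k x)

  -- Every walk of length k from x to z balances: x + a = z + b with a + b ≤ k
  -- (a counts the forward steps, b the backward ones).
  walk-balance : ∀ {k} {x z : Fin N} → Walk (Cycle N) k x z → ∃₂ λ a b → a + b ≤ k × shift x a ≡ shift z b
  walk-balance here = 0 , 0 , z≤n , refl
  walk-balance {x = x} {z} (step {y = y} (inj₁ y≡x+1) w) with walk-balance w
  ... | a , b , a+b≤k , ya≡zb = suc a , b , s≤s a+b≤k , (begin
    shift x (1 + a)      ≡⟨ shift-+ x 1 a ⟨
    shift (shift x 1) a  ≡⟨ cong (λ t → shift t a) y≡x+1 ⟨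
    shift y a            ≡⟨ ya≡zb ⟩
    shift z b            ∎)
    where open ≡-Reasoning
  walk-balance {suc k} {x} {z} (step {y = y} (inj₂ x≡y+1) w) with walk-balance w
  ... | a , b , a+b≤k , ya≡zb = a , suc b , subst (_≤ suc k) (sym (+-suc a b)) (s≤s a+b≤k) , (begin
    shift x a             ≡⟨ cong (λ t → shift t a) x≡y+1 ⟩
    shift (shift y 1) a   ≡⟨ shift-+ y 1 a ⟩
    shift y (1 + a)       ≡⟨ cong (shift y) (+-comm 1 a) ⟩
    shift y (a + 1)       ≡⟨ shift-+ y a 1 ⟨
    shift (shift y a) 1   ≡⟨ cong (λ t → shift t 1) ya≡zb ⟩
    shift (shift z b) 1   ≡⟨ shift-+ z b 1 ⟩
    shift z (b + 1)       ≡⟨ cong (shift z) (+-comm b 1) ⟩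
    shift z (1 + b)       ∎)
    where open ≡-Reasoning

module Windows {n : ℕ} .{{_ : NonZero n}} (q : ℕ) (D : Subset n) where

  Window : Fin n → Fin n → Set
  Window = InWindow q

  Outside : Fin n → Fin n → Set
  Outside i z = z ∈ D × ¬ Window i z

  SameOutside : Fin n → Fin n → Set
  SameOutside i i′ = ∀ z → Outside i z ⇔ Outside i′ z

  Separating : Set
  Separating = (∀ i → ∃[ z ] Outside i z) × (∀ i i′ → ¬ i ≡ i′ → ¬ SameOutside i i′)

  Free : Fin n → Set
  Free i = ∀ z → Window i z → z ∉ D

  Covering : Set
  Covering = ∀ (i : Fin n) → (i ∈ D) ⊎ (shift i q ∈ D)

  UniqueFree : Set
  UniqueFree = ∀ (i i′ : Fin n) → Free i → Free i′ → ∀ z → Window i z ⇔ Window i′ z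

  SameOutside-sym : ∀ i i′ → SameOutside i i′ → SameOutside i′ i
  SameOutside-sym _ _ same z = ⇔.sym (same z)

  free⇒outside : ∀ i {z} → Free i → z ∈ D → Outside i z
  free⇒outside _ free z∈D = z∈D , λ w → free _ w z∈D

  distinguishes : ∀ u v {z} → z ∈ D → Window u z → ¬ Window v z → ¬ (∀ y → Outside v y → Outside u y)
  distinguishes _ _ {z} z∈D in-u notin-v included = proj₂ (included z (z∈D , notin-v)) in-u

module WindowCombinatorics (m q : ℕ) (D : Subset (suc m)) (1≤q : 1 ≤ q) (2q+1<N : suc (q + q) < suc m) where
  open Rotation m
  open Windows q D

  sum<N : ∀ {a b} → a ≤ q → b ≤ q → a + b < N
  sum<N a≤q b≤q = <-trans (s≤s (+-mono-≤ a≤q b≤q)) 2q+1<N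

  q<N : q < N
  q<N = subst (_< N) (+-identityʳ q) (sum<N ≤-refl z≤n)

  window-offset : ∀ i {k} → k < N → Window i (shift i k) → 1 ≤ k × k ≤ q
  window-offset i k<N (j , j-bounds , e) with shift-injective i k<N (≤-<-trans (proj₂ j-bounds) q<N) e
  ... | refl = j-bounds

  beyond-window : ∀ i {k} → q < k → k < N → ¬ Window i (shift i k)
  beyond-window i q<k k<N w = <⇒≱ q<k (proj₂ (window-offset i k<N w))

  first-in-window : ∀ i → Window i (shift i 1)
  first-in-window i = 1 , (≤-refl , 1≤q) , refl

  -- W(i−1) = W(i) ∪ {x_i} ∖ {x_{i+q}}, where i−1 = i + m.
  retreat-advance : ∀ i j → shift (shift i m) (suc j) ≡ shift i j
  retreat-advance i j = begin
    shift (shift i m) (1 + j)          ≡⟨ shift-+ (shift i m) 1 j ⟨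
    shift (shift (shift i m) 1) j      ≡⟨ cong (λ t → shift t j) (shift-turn i (+-comm m 1)) ⟩
    shift i j                          ∎
    where open ≡-Reasoning

  window-retreat : ∀ i {z} → Window i z → ¬ z ≡ shift i q → Window (shift i m) z
  window-retreat i (j , (1≤j , j≤q) , z≡) z≢ with j ≟ q
  ... | yes refl = ⊥-elim (z≢ z≡)
  ... | no j≢q = suc j , (s≤s z≤n , ≤∧≢⇒< j≤q j≢q) , trans z≡ (sym (retreat-advance i j))

  window-advance : ∀ i {z} → Window (shift i m) z → ¬ z ≡ i → Window i z
  window-advance i (1 , _ , z≡) z≢ = ⊥-elim (z≢ (trans z≡ (trans (retreat-advance i 0) (shift-0 i))))
  window-advance i (suc (suc j) , (_ , j+2≤q) , z≡) _ =
    suc j , (s≤s z≤n , ≤-trans (n≤1+n (suc j)) j+2≤q) , trans z≡ (retreat-advance i (suc j))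

  -- (1) is necessary: if x_i, x_{i+q} ∉ D then D ∖ W(i−1) = D ∖ W(i).
  separating⇒covering : Separating → Covering
  separating⇒covering (_ , separated) i with i ∈? D | shift i q ∈? D
  ... | yes i∈D | _ = inj₁ i∈D
  ... | no _ | yes i+q∈D = inj₂ i+q∈D
  ... | no i∉D | no i+q∉D = ⊥-elim (separated (shift i m) i i−1≢i same)
    where
    i−1≢i : ¬ shift i m ≡ i
    i−1≢i e = <⇒≢ (≤-trans (s≤s z≤n) (s≤s⁻¹ 2q+1<N)) (sym m≡0)
      where m≡0 : m ≡ 0
            m≡0 = shift-injective i (n<1+n m) (s≤s z≤n) (trans e (sym (shift-0 i)))
    same : SameOutside (shift i m) i
    same z = mk⇔
      (λ (z∈D , ∉W[i−1]) → z∈D , λ w → ∉W[i−1] (window-retreat i w (λ e → i+q∉D (subst (_∈ D) e z∈D))))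
      (λ (z∈D , ∉W[i]) → z∈D , λ w → ∉W[i] (window-advance i w (λ e → i∉D (subst (_∈ D) e z∈D))))

  -- (2) is necessary: two free windows have D ∖ W = D, hence the same base.
  separating⇒uniqueFree : Separating → UniqueFree
  separating⇒uniqueFree (_ , separated) i i′ free free′ with i ≟ᶠ i′
  ... | yes refl = λ _ → ⇔.refl
  ... | no i≢i′ = ⊥-elim (separated i i′ i≢i′ λ z →
        mk⇔ (λ (z∈D , _) → free⇒outside i′ free′ z∈D) (λ (z∈D , _) → free⇒outside i free z∈D))

  -- Under (1), D ∖ W(i) contains x_{i+q+1} or x_{i+2q+1}.
  covering⇒nonempty : Covering → ∀ i → ∃[ z ] Outside i z
  covering⇒nonempty covering i with covering (shift i (suc q))
  ... | inj₁ z∈D = _ , z∈D , beyond-window i ≤-refl (≤-<-trans (s≤s (m≤m+n q q)) 2q+1<N)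
  ... | inj₂ z∈D = _ , z∈D , subst (λ z → ¬ Window i z) (sym (shift-+ i (suc q) q))
                              (beyond-window i (s≤s (m≤m+n q q)) 2q+1<N)

  -- Under (1), windows at distance d ∈ [1, q] are told apart by x_{i+1} or x_{i+q+1}.
  near-separated : Covering → ∀ i {d} → 1 ≤ d → d ≤ q → ¬ SameOutside i (shift i d)
  near-separated covering i {d} 1≤d d≤q same with covering (shift i 1)
  ... | inj₁ z∈D = distinguishes i (shift i d) z∈D (first-in-window i) not-in-W[i+d] (λ z → Equivalence.from (same z))
    where
    not-in-W[i+d] : ¬ Window (shift i d) (shift i 1)
    not-in-W[i+d] (j , (1≤j , j≤q) , e) = <⇒≢ (+-mono-≤ 1≤d 1≤j)
      (shift-injective i (sum<N 1≤q z≤n) (sum<N d≤q j≤q) (trans e (shift-+ i d j)))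
  ... | inj₂ z∈D = distinguishes (shift i d) i z∈D in-W[i+d] (subst (λ z → ¬ Window i z) (sym (shift-+ i 1 q)) not-in-W[i])
                     (λ z → Equivalence.to (same z))
    where
    not-in-W[i] : ¬ Window i (shift i (suc q))
    not-in-W[i] = beyond-window i ≤-refl (≤-<-trans (s≤s (m≤m+n q q)) 2q+1<N)
    in-W[i+d] : Window (shift i d) (shift (shift i 1) q)
    in-W[i+d] = suc q ∸ d , (m+n≤o⇒m≤o∸n 1 (s≤s d≤q) , ∸-monoʳ-≤ (suc q) 1≤d) , (begin
      shift (shift i 1) q          ≡⟨ shift-+ i 1 q ⟩
      shift i (suc q)              ≡⟨ cong (shift i) (m+[n∸m]≡n (≤-trans d≤q (n≤1+n q))) ⟨
      shift i (d + (suc q ∸ d))    ≡⟨ shift-+ i d (suc q ∸ d) ⟨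
      shift (shift i d) (suc q ∸ d) ∎)
      where open ≡-Reasoning

  far-disjoint : ∀ i {d z} → q < d → d + q < N → Window i z → Window (shift i d) z → ⊥
  far-disjoint i {d} q<d d+q<N (j , (_ , j≤q) , z≡i+j) (j′ , (_ , j′≤q) , z≡i+d+j′) =
    <⇒≱ (<-≤-trans q<d (m≤m+n d j′)) (subst (_≤ q) j≡d+j′ j≤q)
    where
    j≡d+j′ : j ≡ d + j′
    j≡d+j′ = shift-injective i (≤-<-trans j≤q q<N) (≤-<-trans (+-monoʳ-≤ d j′≤q) d+q<N)
               (trans (sym z≡i+j) (trans z≡i+d+j′ (shift-+ i d j′)))

  disjoint-same⇒free : ∀ u v → (∀ z → Window u z → Window v z → ⊥) → SameOutside u v → Free u
  disjoint-same⇒free _ _ disjoint same z w z∈D =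
    proj₂ (Equivalence.from (same z) (z∈D , disjoint z w)) w

  separated-at : Covering → UniqueFree → ∀ i {d} → 0 < d → d < N → ¬ SameOutside i (shift i d)
  separated-at covering unique i {d} 0<d d<N same with d ≤? q
  ... | yes d≤q = near-separated covering i 0<d d≤q same
  ... | no d≰q with N ≤? d + q
  ...   | yes N≤d+q = near-separated covering (shift i d) (m<n⇒0<n∸m d<N) (m≤n+o⇒m∸n≤o N d N≤d+q)
                        (subst (SameOutside (shift i d)) (sym (shift-turn i (m+[n∸m]≡n (<⇒≤ d<N))))
                               (SameOutside-sym i (shift i d) same))
  ...   | no N≰d+q = disjoint (shift i 1) (first-in-window i)
                       (Equivalence.to (unique i (shift i d) free free′ (shift i 1)) (first-in-window i))
    where
    disjoint : ∀ z → Window i z → Window (shift i d) z → ⊥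
    disjoint z = far-disjoint i (≰⇒> d≰q) (≰⇒> N≰d+q)
    free : Free i
    free = disjoint-same⇒free i (shift i d) disjoint same
    free′ : Free (shift i d)
    free′ = disjoint-same⇒free (shift i d) i (λ z w′ w → disjoint z w w′) (SameOutside-sym i (shift i d) same)

  separating⇔covering×uniqueFree : Separating ⇔ (Covering × UniqueFree)
  separating⇔covering×uniqueFree = mk⇔
    (λ separating → separating⇒covering separating , separating⇒uniqueFree separating)
    (λ (covering , unique) → covering⇒nonempty covering , separated covering unique)
    where
    separated : Covering → UniqueFree → ∀ i i′ → ¬ i ≡ i′ → ¬ SameOutside i i′
    separated covering unique i i′ i≢i′ same with offset i i′ in eq
    ... | zero = i≢i′ (trans (sym (shift-0 i)) (trans (cong (shift i) (sym eq)) (shift-offset i i′)))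
    ... | suc d = separated-at covering unique i (s≤s z≤n)
                    (subst (_< N) eq (offset<N i i′))
                    (subst (SameOutside i) (trans (sym (shift-offset i i′)) (cong (shift i) eq)) same)

module Ball (r q : ℕ) where
  open Rotation (r + r + q)

  r<N : r < N
  r<N = s≤s (≤-trans (m≤m+n r r) (m≤m+n (r + r) q))

  within-r⇔outside-window : ∀ x z → DistLE (Cycle N) r x z ⇔ (¬ InWindow q (shift x r) z)
  within-r⇔outside-window x z = mk⇔ within⇒outside outside⇒within
    where
    within⇒outside : DistLE (Cycle N) r x z → ¬ InWindow q (shift x r) z
    within⇒outside (k , k≤r , walk) (j , (1≤j , j≤q) , z≡x+r+j) with walk-balance walk
    ... | a , b , a+b≤k , x+a≡z+b =
      <⇒≱ (<-≤-trans (m<m+n r 1≤j) (m≤m+n (r + j) b)) (subst (_≤ r) a≡r+j+b a≤r)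
      where
      open ≡-Reasoning
      a≤r : a ≤ r
      a≤r = ≤-trans (m≤m+n a b) (≤-trans a+b≤k k≤r)
      b≤r : b ≤ r
      b≤r = ≤-trans (m≤n+m b a) (≤-trans a+b≤k k≤r)
      swap-last : ∀ u v w → u + v + w ≡ u + w + v
      swap-last = solve-∀
      r+j+b<N : r + j + b < N
      r+j+b<N = s≤s (subst (_≤ r + r + q) (swap-last r b j) (+-mono-≤ (+-monoʳ-≤ r b≤r) j≤q))
      a≡r+j+b : a ≡ r + j + b
      a≡r+j+b = shift-injective x (≤-<-trans a≤r r<N) r+j+b<N (begin
        shift x a                      ≡⟨ x+a≡z+b ⟩
        shift z b                      ≡⟨ cong (λ t → shift t b) z≡x+r+j ⟩
        shift (shift (shift x r) j) b  ≡⟨ cong (λ t → shift t b) (shift-+ x r j) ⟩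
        shift (shift x (r + j)) b      ≡⟨ shift-+ x (r + j) b ⟩
        shift x (r + j + b)            ∎)

    -- Write z = x + o with o < N: walk forward if o ≤ r, backward if o > r + q.
    outside⇒within : ¬ InWindow q (shift x r) z → DistLE (Cycle N) r x z
    outside⇒within outside with offset x z ≤? r
    ... | yes o≤r = offset x z , o≤r , subst (Walk (Cycle N) _ x) (shift-offset x z) (walk-forward _ x)
    ... | no o≰r with offset x z ≤? r + q
    ...   | yes o≤r+q = ⊥-elim (outside (o ∸ r , (m<n⇒0<n∸m (≰⇒> o≰r) , m≤n+o⇒m∸n≤o o r o≤r+q) , (begin
      z                         ≡⟨ shift-offset x z ⟨
      shift x o                 ≡⟨ cong (shift x) (m+[n∸m]≡n (<⇒≤ (≰⇒> o≰r))) ⟨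
      shift x (r + (o ∸ r))     ≡⟨ shift-+ x r (o ∸ r) ⟨
      shift (shift x r) (o ∸ r) ∎)))
      where
      open ≡-Reasoning
      o = offset x z
    ...   | no o≰r+q = N ∸ o , m≤n+o⇒m∸n≤o N o N≤o+r , subst (λ w → Walk (Cycle N) (N ∸ o) w z) z−[N∸o]≡x (walk-backward (N ∸ o) z)
      where
      o = offset x z
      N-as-sum : ∀ u v → suc (u + u + v) ≡ suc (u + v) + u
      N-as-sum = solve-∀
      N≤o+r : N ≤ o + r
      N≤o+r = subst (_≤ o + r) (sym (N-as-sum r q)) (+-monoˡ-≤ r (≰⇒> o≰r+q))
      z−[N∸o]≡x : shift z (N ∸ o) ≡ x
      z−[N∸o]≡x = trans (cong (λ t → shift t (N ∸ o)) (sym (shift-offset x z)))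
                        (shift-turn x (m+[n∸m]≡n (<⇒≤ (offset<N x z))))

  back : Fin N → Fin N
  back i = shift i (N ∸ r)

  forward-back : ∀ i → shift (back i) r ≡ i
  forward-back i = shift-turn i (m∸n+n≡m (<⇒≤ r<N))

  back-forward : ∀ x → back (shift x r) ≡ x
  back-forward x = shift-turn x (m+[n∸m]≡n (<⇒≤ r<N))

  module _ (D : Subset N) where
    open Windows q D

    neighbourhood : ∀ {x i} → shift x r ≡ i → ∀ z → InDr (Cycle N) r D x z ⇔ Outside i z
    neighbourhood {x} refl z = mk⇔
      (λ (within , z∈D) → z∈D , Equivalence.to (within-r⇔outside-window x z) within)
      (λ (z∈D , outside) → Equivalence.from (within-r⇔outside-window x z) outside , z∈D)

    same-neighbourhood⇔same-outside : ∀ {x y i i′} → shift x r ≡ i → shift y r ≡ i′ →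
      (∀ z → InDr (Cycle N) r D x z ⇔ InDr (Cycle N) r D y z) ⇔ SameOutside i i′
    same-neighbourhood⇔same-outside x+r≡i y+r≡i′ = mk⇔
      (λ same z → ⇔.trans (⇔.sym (neighbourhood x+r≡i z)) (⇔.trans (same z) (neighbourhood y+r≡i′ z)))
      (λ same z → ⇔.trans (neighbourhood x+r≡i z) (⇔.trans (same z) (⇔.sym (neighbourhood y+r≡i′ z))))

    code⇔separating : IsIdentifyingCode (Cycle N) r D ⇔ Separating
    code⇔separating = mk⇔ code⇒separating separating⇒code
      where
      code⇒separating : IsIdentifyingCode (Cycle N) r D → Separating
      code⇒separating (nonempty , separated) =
        (λ i → let z , z∈Dr = nonempty (back i) in z , Equivalence.to (neighbourhood (forward-back i) z) z∈Dr) ,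
        (λ i i′ i≢i′ same → separated (back i) (back i′)
          (λ e → i≢i′ (trans (sym (forward-back i)) (trans (cong (λ t → shift t r) e) (forward-back i′))))
          (Equivalence.from (same-neighbourhood⇔same-outside (forward-back i) (forward-back i′)) same))
      separating⇒code : Separating → IsIdentifyingCode (Cycle N) r D
      separating⇒code (nonempty , separated) =
        (λ x → let z , z∉W = nonempty (shift x r) in z , Equivalence.from (neighbourhood refl z) z∉W) ,
        (λ x y x≢y same → separated (shift x r) (shift y r)
          (λ e → x≢y (trans (sym (back-forward x)) (trans (cong back e) (back-forward y))))
          (Equivalence.to (same-neighbourhood⇔same-outside refl refl) same))

cycle-characterisation : ∀ r q n .{{_ : NonZero n}} → n ≡ suc (r + r + q) → 1 ≤ q → q < r + r →
  (D : Subset n) → IsIdentifyingCode (Cycle n) r D ⇔ (Windows.Covering q D × Windows.UniqueFree q D)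
cycle-characterisation r q _ refl 1≤q q<2r D =
  ⇔.trans (Ball.code⇔separating r q D)
          (WindowCombinatorics.separating⇔covering×uniqueFree (r + r + q) q D 1≤q (s≤s (+-monoˡ-< q q<2r)))

lemma6 : (r n : ℕ) .{{_ : NonZero n}} → 1 ≤ r → 2 * r + 5 ≤ n → n ≤ 3 * r + 1 → (D : Subset n) →
    let q = n ∸ (2 * r + 1) in
    IsIdentifyingCode (Cycle n) r D
      ⇔ ((∀ (i : Fin n) → (i ∈ D) ⊎ (shift i q ∈ D))
         × (∀ (i i′ : Fin n) → (∀ z → InWindow q i z → z ∉ D) → (∀ z → InWindow q i′ z → z ∉ D)
              → ∀ z → InWindow q i z ⇔ InWindow q i′ z))
lemma6 r n 1≤r 2r+5≤n n≤3r+1 D = cycle-characterisation r q n n≡2r+1+q 1≤q q<2r D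
  where
  q = n ∸ (2 * r + 1)
  2r+2≤n : suc (2 * r + 1) ≤ n
  2r+2≤n = subst (_≤ n) (+-suc (2 * r) 1) (≤-trans (+-monoʳ-≤ (2 * r) (s≤s (s≤s z≤n))) 2r+5≤n)
  q+[2r+1]≡1+r+r+q : ∀ r q → q + (2 * r + 1) ≡ suc (r + r + q)
  q+[2r+1]≡1+r+r+q = solve-∀
  n≡2r+1+q : n ≡ suc (r + r + q)
  n≡2r+1+q = trans (sym (m∸n+n≡m (≤-trans (n≤1+n _) 2r+2≤n))) (q+[2r+1]≡1+r+r+q r q)
  1≤q : 1 ≤ q
  1≤q = m+n≤o⇒m≤o∸n 1 2r+2≤n
  3r+1≡[2r+1]+r : ∀ r → 3 * r + 1 ≡ 2 * r + 1 + r
  3r+1≡[2r+1]+r = solve-∀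
  q<2r : q < r + r
  q<2r = ≤-<-trans (m≤n+o⇒m∸n≤o n (2 * r + 1) (subst (n ≤_) (3r+1≡[2r+1]+r r) n≤3r+1)) (m<m+n r 1≤r)
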